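{- Let $n,r,s\ge 1$ be integers and $k=2rs+r+s$, so that $2k+1=(2r+1)(2s+1)$. If $G\in\mathcal G_{2n+1}(2r+1,2s+1)$ (defined below), then $\chi_{la}(G)=3$.
   Context: For a graph $G$ with $q$ edges, a bijection $f:E(G)\to\{1,\dots,q\}$ is a local antimagic labeling if $f^+(u)\neq f^+(v)$ for every edge $uv$, where $f^+(u)$ is the sum of the labels of edges incident to $u$; $\chi_{la}(G)$ is the minimum number of distinct values of $f^+$ over all local antimagic labelings of $G$. Definition of $\mathcal G_{2n+1}(2r+1,2s+1)$. Let $E=4k+2$. Let $\Gamma$ be the graph with vertices $u_i,v_i,x_{i,j}$ ($1\le i\le 2k+1$, $1\le j\le 2n+1$) and edges $u_iv_i,u_ix_{i,j},v_ix_{i,j}$; thus $\Gamma$ is $2k+1$ disjoint copies of $P_2\vee O_{2n+1}$. Define the bijection $f:E(\Gamma)\to[1,(2k+1)(4n+3)]$ by, for every $1\le i\le 2k+1$: $f(u_iv_i)=i$, $f(v_ix_{i,1})=4k+3-i$, $f(u_ix_{i,2n+1})=2k+2-i+(n+1)E$, and for each $t\in\{1,\dots,n\}$: $f(u_ix_{i,2n-2t+1})=6k+4-i+(n+t)E$, $f(u_ix_{i,2n-2t+2})=2k+1+i+(n+t)E$, $f(v_ix_{i,2t})=2k+2-i+tE$, $f(v_ix_{i,2t+1})=2k+1+i+tE$. Let $\sigma_j(i)=f(u_ix_{i,j})+f(v_ix_{i,j})$. The class $\mathcal G_{2n+1}(2r+1,2s+1)$ consists of all graphs obtained from $\Gamma$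 as follows: for each $j\in[1,2n+1]$ choose (independently) a partition of $\{1,\dots,2k+1\}$ into $2r+1$ blocks, each of size $2s+1$, such that $\sum_{i\in B}\sigma_j(i)=(2s+1)[(8k+5)+2n(4k+2)]$ for each block $B$; then for each $j$ and each block $B$ of the $j$-th partition, identify the vertices $x_{i,j}$, $i\in B$, into a single vertex (adjacent to $u_i,v_i$ for $i\in B$, hence of degree $2(2s+1)$). -}

module Defs where

open import Data.Nat using (ℕ; zero; suc; _+_; _*_; _∸_; _≥_; ⌊_/2⌋)
open import Data.Nat.Properties using () renaming (_≟_ to _≟ℕ_)
open import Data.Bool using (Bool; true; false; if_then_else_)
open import Data.Fin using (Fin; toℕ; splitAt; remQuot; _↑ˡ_; _↑ʳ_; combine)
open import Data.Fin.Properties using (_≟_)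
open import Data.Nat.ListAction using (sum)
open import Data.List using (List; map; filter; length; allFin; deduplicate)
open import Data.Product using (_×_; _,_; proj₁; proj₂; Σ; ∃)
open import Data.Sum using ([_,_]′)
open import Function.Bundles using (_⤖_; Bijection)
open import Relation.Nullary using (¬_)
open import Relation.Nullary.Decidable using (⌊_⌋)
open import Relation.Binary.PropositionalEquality using (_≡_; _≢_)

record Graph : Set where
  field
    nV   : ℕ
    nE   : ℕ
    ends : Fin nE → Fin nV × Fin nV
open Graph public

-- A labeling is a bijection E(G) → {1,…,q}, q = |E(G)|, represented as a
-- bijection Fin q ⤖ Fin q; the label of e is (toℕ (to e)) + 1.
Labeling : Graph → Set
Labeling G = Fin (nE G) ⤖ Fin (nE G)

label : (G : Graph) → Labeling G → Fin (nE G) → ℕ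
label G f e = suc (toℕ (Bijection.to f e))

contrib : (G : Graph) → Labeling G → Fin (nV G) → Fin (nE G) → ℕ
contrib G f w e =
  (if ⌊ w ≟ proj₁ (ends G e) ⌋ then label G f e else 0)
  + (if ⌊ w ≟ proj₂ (ends G e) ⌋ then label G f e else 0)

f⁺ : (G : Graph) → Labeling G → Fin (nV G) → ℕ
f⁺ G f w = sum (map (contrib G f w) (allFin (nE G)))

IsLocalAntimagic : (G : Graph) → Labeling G → Set
IsLocalAntimagic G f =
  (e : Fin (nE G)) → f⁺ G f (proj₁ (ends G e)) ≢ f⁺ G f (proj₂ (ends G e))

numValues : (G : Graph) → Labeling G → ℕ
numValues G f = length (deduplicate _≟ℕ_ (map (f⁺ G f) (allFin (nV G))))

χla≡ : Graph → ℕ → Set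
χla≡ G c =
  (Σ (Labeling G) λ f → IsLocalAntimagic G f × numValues G f ≡ c)
  × ((f : Labeling G) → IsLocalAntimagic G f → numValues G f ≥ c)

-- The labeling f of Γ (indices i are 1-based, i ∈ [1,2k+1];
-- j0 = j - 1 is the 0-based version of j ∈ [1,2n+1])

isOdd : ℕ → Bool
isOdd zero = false
isOdd (suc m) with isOdd m
... | true  = false
... | false = true

-- f(v_i x_{i,j}), j = j0 + 1
fV : (k n i j0 : ℕ) → ℕ
fV k n i zero = 4 * k + 3 ∸ i                                    -- j = 1
fV k n i (suc j0) =
  if isOdd (suc j0)
  then (2 * k + 2 ∸ i) + ⌊ suc (suc j0) /2⌋ * (4 * k + 2)          -- j = 2t
  else (2 * k + 1 + i) + ⌊ suc j0 /2⌋ * (4 * k + 2)                -- j = 2t+1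

-- f(u_i x_{i,j}), j = j0 + 1
fU : (k n i j0 : ℕ) → ℕ
fU k n i j0 =
  if ⌊ j0 ≟ℕ 2 * n ⌋
  then (2 * k + 2 ∸ i) + (n + 1) * (4 * k + 2)                     -- j = 2n+1
  else (if isOdd j0
        then (2 * k + 1 + i) + (n + (n ∸ ⌊ j0 /2⌋)) * (4 * k + 2)   -- j = 2n-2t+2
        else (6 * k + 4 ∸ i) + (n + (n ∸ ⌊ j0 /2⌋)) * (4 * k + 2))  -- j = 2n-2t+1

σ : (k n : ℕ) → Fin (2 * k + 1) → Fin (2 * n + 1) → ℕ
σ k n i j = fU k n (suc (toℕ i)) (toℕ j) + fV k n (suc (toℕ i)) (toℕ j)

-- A choice of partitions: for each j, a map assigning each i ∈ [1,2k+1]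
-- to one of 2r+1 blocks.
Partitions : (k n r : ℕ) → Set
Partitions k n r = Fin (2 * n + 1) → Fin (2 * k + 1) → Fin (2 * r + 1)

block : {k n r : ℕ} → Partitions k n r → Fin (2 * n + 1) → Fin (2 * r + 1)
      → List (Fin (2 * k + 1))
block {k} P j b = filter (λ i → P j i ≟ b) (allFin (2 * k + 1))

ValidPartitions : (k n r s : ℕ) → Partitions k n r → Set
ValidPartitions k n r s P =
  (j : Fin (2 * n + 1)) (b : Fin (2 * r + 1)) →
    (length (block {k} {n} {r} P j b) ≡ 2 * s + 1)
    × (sum (map (λ i → σ k n i j) (block {k} {n} {r} P j b))
        ≡ (2 * s + 1) * ((8 * k + 5) + 2 * n * (4 * k + 2)))

-- The graph obtained from Γ by identifying, for each j and each block B of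
-- the j-th partition, the vertices x_{i,j} (i ∈ B).
-- Vertices: u_i, v_i (i ∈ Fin (2k+1)), and x_{j,b} (j ∈ Fin (2n+1), b ∈ Fin (2r+1)).
-- Edges: u_i v_i, u_i x_{i,j}, v_i x_{i,j}  (x_{i,j} becomes x_{j, P j i}).
module _ (k n r : ℕ) where
  private
    K = 2 * k + 1
    N = 2 * n + 1
    R = 2 * r + 1

  uV : Fin K → Fin (K + K + N * R)
  uV i = (i ↑ˡ K) ↑ˡ (N * R)

  vV : Fin K → Fin (K + K + N * R)
  vV i = (K ↑ʳ i) ↑ˡ (N * R)

  xV : Fin N → Fin R → Fin (K + K + N * R)
  xV j b = (K + K) ↑ʳ combine j b

  GraphOf : Partitions k n r → Graph
  GraphOf P = record
    { nV   = K + K + N * R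
    ; nE   = K + (K * N + K * N)
    ; ends = [ (λ i → uV i , vV i)
             , [ (λ c → let ij = remQuot {K} N c in
                          uV (proj₁ ij) , xV (proj₂ ij) (P (proj₂ ij) (proj₁ ij)))
               , (λ c → let ij = remQuot {K} N c in
                          vV (proj₁ ij) , xV (proj₂ ij) (P (proj₂ ij) (proj₁ ij)))
               ]′ ∘S splitAt (K * N) ]′ ∘S splitAt K
    }
    where
    _∘S_ : {A B C : Set} → (B → C) → (A → B) → A → C
    (g ∘S h) x = g (h x)

InClass : (k n r s : ℕ) → Graph → Set
InClass k n r s G =
  Σ (Partitions k n r) λ P → ValidPartitions k n r s P × GraphOf k n r P ≡ G

-- Every local antimagic labeling needs three values, since u₁ v₁ and any x adjacent to both form
-- a triangle. Written in base K = 2k + 1, f(e) − 1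
-- has a different pair of digits on every edge, so f is a bijection onto [1, q]. Grouping the
-- labels at u_i and at v_i into consecutive pairs whose sums do not depend on i gives
-- f⁺(u_i) = (n + 1) + (6n² + 8n + 3)K and f⁺(v_i) = (n + 1) + 2(n + 1)²K, and the admissibility
-- of the partitions gives f⁺(x) = S + 4S(n + 1)K with S = 2s + 1. These three values are
-- distinct: compare base-K digits when n + 1 < K, and sizes when n + 1 ≥ K ≥ 3S.
module Submission where

open import Defs
open import Data.Nat
  using (ℕ; zero; suc; _+_; _*_; _∸_; _≤_; _<_; _≥_; z≤n; s≤s; z<s; ≢-nonZero; ⌊_/2⌋)
open import Data.Nat.DivMod using (_%_; m<n⇒m%n≡m; [m+kn]%n≡m%n)
open import Data.Nat.ListAction using (sum)
open import Data.Nat.Properties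
  using ( _<?_; +-0-commutativeMonoid; +-comm; +-assoc; +-suc; *-suc; +-identityʳ
        ; +-cancelˡ-≡; *-cancelʳ-≡; *-cancelˡ-≡; *-cancelˡ-≤; *-cancelˡ-<
        ; ≤-refl; ≤-trans; <-≤-trans; ≤-antisym; <⇒≢; ≮⇒≥; 1+n≰n; m<1+n⇒m≤n
        ; +-mono-≤; +-mono-<-≤; *-monoˡ-≤; *-monoʳ-≤; m≤m+n; m<m+n
        ; even≢odd; 0≢1+n; m+1+n≢0; m+1+n≢m; m+n∸m≡n; m∸n+n≡m; m+[n∸m]≡n; +-∸-assoc
        ; m≤n⇒∃[o]m+o≡n; module ≤-Reasoning)
  renaming (_≟_ to _≟ℕ_)
open import Data.Nat.Tactic.RingSolver using (solve-∀; solve)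
open import Algebra.Properties.CommutativeMonoid.Sum +-0-commutativeMonoid
  using (sum-syntax; sum-cong-≗; sum-replicate-zero; sum-init-last; ∑-distrib-+)
open import Data.Bool using (Bool; true; false; if_then_else_; not; _∧_)
open import Data.Fin
  using (Fin; toℕ; _↑ˡ_; _↑ʳ_; splitAt; join; combine; remQuot; opposite; cast; punchOut)
  renaming (zero to fzero; suc to fsuc)
open import Data.Fin.Properties
  using ( _≟_; any?; toℕ<n; toℕ-injective; toℕ-inject₁; toℕ-fromℕ; toℕ-cast
        ; toℕ-↑ˡ; toℕ-↑ʳ; toℕ-combine; ↑ˡ-injective; ↑ʳ-injective; combine-injective
        ; splitAt-↑ˡ; splitAt-↑ʳ; join-splitAt; remQuot-combine; combine-remQuot
        ; opposite-prop; opposite-involutive; punchOut-injective; injective⇒≤)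
import Data.Fin.Properties as Fin
open import Data.List using (List; []; _∷_; map; filter; length; allFin; tabulate; deduplicate)
open import Data.List.Properties using (map-tabulate; length-removeAt′)
import Data.List.Relation.Unary.All as All
open import Data.List.Relation.Unary.AllPairs using ([]; _∷_)
open import Data.List.Relation.Unary.Any using (here; there; index; _─_)
open import Data.List.Relation.Unary.Unique.Propositional using (Unique)
open import Data.List.Relation.Unary.Unique.DecPropositional.Properties _≟ℕ_
  using (deduplicate-!)
open import Data.List.Relation.Binary.Subset.Propositional using (_⊆_)
open import Data.List.Membership.Propositional using (_∈_)
open import Data.List.Membership.Propositional.Properties
  using (∈-map⁺; ∈-map⁻; ∈-allFin; ∈-deduplicate⁺; ∈-deduplicate⁻)
open import Data.Product using (_×_; _,_; proj₁; proj₂; uncurry)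
open import Data.Sum using (_⊎_; inj₁; inj₂; [_,_]′)
open import Function using (_∘_)
open import Function.Bundles using (mk⤖)
open import Function.Definitions using (Injective; Surjective)
open import Relation.Nullary using (¬_; Dec; yes; no)
open import Relation.Nullary.Decidable using (⌊_⌋; dec-true; dec-false; isYes≗does)
open import Relation.Nullary.Negation using (contradiction)
open import Relation.Binary.PropositionalEquality

⌊⌋-yes : ∀ {A : Set} (d : Dec A) → A → ⌊ d ⌋ ≡ true
⌊⌋-yes d a = trans (isYes≗does d) (dec-true d a)

⌊⌋-no : ∀ {A : Set} (d : Dec A) → ¬ A → ⌊ d ⌋ ≡ false
⌊⌋-no d ¬a = trans (isYes≗does d) (dec-false d ¬a)

if-yes : ∀ {A B : Set} (d : Dec A) {x y : B} → A → (if ⌊ d ⌋ then x else y) ≡ x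
if-yes (yes _) _ = refl
if-yes (no ¬a) a = contradiction a ¬a

if-no : ∀ {A B : Set} (d : Dec A) {x y : B} → ¬ A → (if ⌊ d ⌋ then x else y) ≡ y
if-no (yes a) ¬a = contradiction a ¬a
if-no (no _)  _  = refl

≟-sym : ∀ {m} (a b : Fin m) → ⌊ a ≟ b ⌋ ≡ ⌊ b ≟ a ⌋
≟-sym a b with a ≟ b
... | yes refl = sym (⌊⌋-yes (a ≟ a) refl)
... | no a≢b   = sym (⌊⌋-no (b ≟ a) (a≢b ∘ sym))

sum-map-allFin : ∀ m (g : Fin m → ℕ) → sum (map g (allFin m)) ≡ ∑[ i < m ] g i
sum-map-allFin m g = trans (cong sum (map-tabulate (λ i → i) g)) (sum-tabulate m g)
  where
  sum-tabulate : ∀ m (g : Fin m → ℕ) → sum (tabulate g) ≡ ∑[ i < m ] g i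
  sum-tabulate zero    g = refl
  sum-tabulate (suc m) g = cong (g fzero +_) (sum-tabulate m (g ∘ fsuc))

sum-map-filter : ∀ {A : Set} {P : A → Set} (P? : ∀ x → Dec (P x)) (g : A → ℕ) xs →
  sum (map g (filter P? xs)) ≡ sum (map (λ x → if ⌊ P? x ⌋ then g x else 0) xs)
sum-map-filter P? g []       = refl
sum-map-filter P? g (x ∷ xs) with P? x
... | yes _ = cong (g x +_) (sum-map-filter P? g xs)
... | no  _ = sum-map-filter P? g xs

∑-zero : ∀ m → ∑[ i < m ] 0 ≡ 0
∑-zero = sum-replicate-zero

∑∑-zero : ∀ m n → ∑[ i < m ] ∑[ j < n ] 0 ≡ 0
∑∑-zero m n = trans (sum-cong-≗ {m} λ _ → ∑-zero n) (∑-zero m)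

∑-if : ∀ m (b : Bool) (g : Fin m → ℕ) →
  ∑[ i < m ] (if b then g i else 0) ≡ (if b then ∑[ i < m ] g i else 0)
∑-if m true  g = refl
∑-if m false g = ∑-zero m

∑-↑ : ∀ m n (g : Fin (m + n) → ℕ) →
  ∑[ i < m + n ] g i ≡ ∑[ i < m ] g (i ↑ˡ n) + ∑[ j < n ] g (m ↑ʳ j)
∑-↑ zero    n g = refl
∑-↑ (suc m) n g = trans (cong (g fzero +_) (∑-↑ m n (g ∘ fsuc))) (sym (+-assoc (g fzero) _ _))

∑-combine : ∀ m n (g : Fin (m * n) → ℕ) →
  ∑[ c < m * n ] g c ≡ ∑[ i < m ] ∑[ j < n ] g (combine i j)
∑-combine zero    n g = refl
∑-combine (suc m) n g = trans (∑-↑ n (m * n) g)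
  (cong (∑[ j < n ] g (combine {suc m} fzero j) +_) (∑-combine m n λ c → g (n ↑ʳ c)))

∑-single : ∀ m (i₀ : Fin m) (g : Fin m → ℕ) →
  (∀ i → i₀ ≢ i → g i ≡ 0) → ∑[ i < m ] g i ≡ g i₀
∑-single (suc m) fzero g g≡0 = trans
  (cong (g fzero +_) (trans (sum-cong-≗ {m} λ i → g≡0 (fsuc i) λ ()) (∑-zero m)))
  (+-identityʳ _)
∑-single (suc m) (fsuc i₀) g g≡0 =
  trans (cong (_+ ∑[ i < m ] g (fsuc i)) (g≡0 fzero λ ()))
        (∑-single m i₀ (g ∘ fsuc) λ i i₀≢i → g≡0 (fsuc i) (i₀≢i ∘ Fin.suc-injective))

∑-δ : ∀ m (i₀ : Fin m) (g : Fin m → ℕ) →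
  ∑[ i < m ] (if ⌊ i₀ ≟ i ⌋ then g i else 0) ≡ g i₀
∑-δ m i₀ g = trans (∑-single m i₀ _ λ i → if-no (i₀ ≟ i)) (if-yes (i₀ ≟ i₀) refl)

∑-δ+0 : ∀ m (i₀ : Fin m) (g : Fin m → ℕ) →
  ∑[ i < m ] ((if ⌊ i₀ ≟ i ⌋ then g i else 0) + 0) ≡ g i₀
∑-δ+0 m i₀ g = trans (sum-cong-≗ {m} λ i → +-identityʳ _) (∑-δ m i₀ g)

∑∑-δ+0 : ∀ m n (i₀ : Fin m) (g : Fin m → Fin n → ℕ) →
  ∑[ i < m ] ∑[ j < n ] ((if ⌊ i₀ ≟ i ⌋ then g i j else 0) + 0) ≡ ∑[ j < n ] g i₀ j
∑∑-δ+0 m n i₀ g = trans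
  (sum-cong-≗ {m} λ i → trans (sum-cong-≗ {n} λ j → +-identityʳ _) (∑-if n ⌊ i₀ ≟ i ⌋ (g i)))
  (∑-δ m i₀ λ i → ∑[ j < n ] g i j)

∑-δ-∧ : ∀ m (i₀ : Fin m) (c : Fin m → Bool) (g : Fin m → ℕ) →
  ∑[ i < m ] (if ⌊ i₀ ≟ i ⌋ ∧ c i then g i else 0) ≡ (if c i₀ then g i₀ else 0)
∑-δ-∧ m i₀ c g = trans
  (sum-cong-≗ {m} λ i → if-∧ ⌊ i₀ ≟ i ⌋ (c i) (g i))
  (∑-δ m i₀ λ i → if c i then g i else 0)
  where
  if-∧ : ∀ a b (L : ℕ) → (if a ∧ b then L else 0) ≡ (if a then (if b then L else 0) else 0)
  if-∧ true  b L = refl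
  if-∧ false b L = refl

∑-suc : ∀ m (F : ℕ → ℕ) → ∑[ j < suc m ] F (toℕ j) ≡ ∑[ j < m ] F (toℕ j) + F m
∑-suc m F = trans (sum-init-last (λ j → F (toℕ j)))
  (cong₂ _+_ (sum-cong-≗ {m} λ j → cong F (toℕ-inject₁ j)) (cong F (toℕ-fromℕ m)))

∑-suc-suc : ∀ m (F : ℕ → ℕ) →
  ∑[ j < suc (suc m) ] F (toℕ j) ≡ ∑[ j < m ] F (toℕ j) + (F m + F (suc m))
∑-suc-suc m F = trans (∑-suc (suc m) F)
  (trans (cong (_+ F (suc m)) (∑-suc m F)) (+-assoc _ (F m) (F (suc m))))

∈-─ : ∀ {A : Set} {x y : A} {ys} (p : x ∈ ys) → y ∈ ys → x ≢ y → y ∈ (ys ─ p)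
∈-─ (here refl) (here refl) x≢y = contradiction refl x≢y
∈-─ (here refl) (there q)   _   = q
∈-─ (there p)   (here refl) _   = here refl
∈-─ (there p)   (there q)   x≢y = there (∈-─ p q x≢y)

unique-⊆⇒length≤ : ∀ {A : Set} {xs ys : List A} → Unique xs → xs ⊆ ys → length xs ≤ length ys
unique-⊆⇒length≤ []                               _     = z≤n
unique-⊆⇒length≤ {xs = x ∷ xs} {ys} (x∉xs ∷ !xs) xs⊆ys =
  subst (suc (length xs) ≤_) (sym (length-removeAt′ ys (index x∈ys)))
    (s≤s (unique-⊆⇒length≤ !xs λ y∈xs → ∈-─ x∈ys (xs⊆ys (there y∈xs)) (All.lookup x∉xs y∈xs)))
  where
  x∈ys : x ∈ ys
  x∈ys = xs⊆ys (here refl)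

3≤length-deduplicate : ∀ {a b c} (zs : List ℕ) → a ∈ zs → b ∈ zs → c ∈ zs →
  a ≢ b → a ≢ c → b ≢ c → 3 ≤ length (deduplicate _≟ℕ_ zs)
3≤length-deduplicate zs a∈ b∈ c∈ a≢b a≢c b≢c =
  unique-⊆⇒length≤ ((a≢b All.∷ a≢c All.∷ All.[]) ∷ (b≢c All.∷ All.[]) ∷ All.[] ∷ [])
    λ { (here refl)                 → ∈-deduplicate⁺ _≟ℕ_ a∈
      ; (there (here refl))         → ∈-deduplicate⁺ _≟ℕ_ b∈
      ; (there (there (here refl))) → ∈-deduplicate⁺ _≟ℕ_ c∈ }

length-deduplicate≤ : ∀ (zs vs : List ℕ) → zs ⊆ vs → length (deduplicate _≟ℕ_ zs) ≤ length vs
length-deduplicate≤ zs vs zs⊆vs =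
  unique-⊆⇒length≤ (deduplicate-! zs) (zs⊆vs ∘ ∈-deduplicate⁻ _≟ℕ_ zs)

triangle⇒3≤numValues : ∀ G (f : Labeling G) → IsLocalAntimagic G f →
  ∀ {a b c} (e₁ e₂ e₃ : Fin (nE G)) →
  ends G e₁ ≡ (a , b) → ends G e₂ ≡ (a , c) → ends G e₃ ≡ (b , c) → 3 ≤ numValues G f
triangle⇒3≤numValues G f antimagic {a} {b} {c} e₁ e₂ e₃ ab ac bc =
  3≤length-deduplicate (map (f⁺ G f) (allFin (nV G))) (value a) (value b) (value c)
    (differ e₁ ab) (differ e₂ ac) (differ e₃ bc)
  where
  value : ∀ w → f⁺ G f w ∈ map (f⁺ G f) (allFin (nV G))
  value w = ∈-map⁺ (f⁺ G f) (∈-allFin w)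
  differ : ∀ {v w} e → ends G e ≡ (v , w) → f⁺ G f v ≢ f⁺ G f w
  differ e refl = antimagic e

numValues≤length : ∀ G (f : Labeling G) (vs : List ℕ) →
  (∀ w → f⁺ G f w ∈ vs) → numValues G f ≤ length vs
numValues≤length G f vs f⁺∈vs = length-deduplicate≤ (map (f⁺ G f) (allFin (nV G))) vs λ z∈ →
  let w , _ , z≡f⁺w = ∈-map⁻ (f⁺ G f) z∈ in subst (_∈ vs) (sym z≡f⁺w) (f⁺∈vs w)

injective⇒surjective : ∀ {m} {f : Fin m → Fin m} → Injective _≡_ _≡_ f → Surjective _≡_ _≡_ f
injective⇒surjective {m} {f} f-inj y with any? (λ x → f x ≟ y)
... | yes (x , fx≡y) = x , λ { refl → fx≡y }
injective⇒surjective {suc m} {f} f-inj y | no ∄x = contradiction (injective⇒≤ g-inj) 1+n≰n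
  where
  y≢f : ∀ x → y ≢ f x
  y≢f x y≡fx = ∄x (x , sym y≡fx)
  g : Fin (suc m) → Fin m
  g x = punchOut (y≢f x)
  g-inj : Injective _≡_ _≡_ g
  g-inj {x} {x′} = f-inj ∘ punchOut-injective (y≢f x) (y≢f x′)

↑ˡ≢↑ʳ : ∀ {m n} (i : Fin m) (j : Fin n) → i ↑ˡ n ≢ m ↑ʳ j
↑ˡ≢↑ʳ {m} {n} i j eq
  with trans (sym (splitAt-↑ˡ m i n)) (trans (cong (splitAt m) eq) (splitAt-↑ʳ m n j))
... | ()

reflectIf : ∀ {m} → Bool → Fin m → Fin m
reflectIf true  i = opposite i
reflectIf false i = i

reflectIf-injective : ∀ {m} b → Injective _≡_ _≡_ (reflectIf {m} b)
reflectIf-injective true  {i} {i′} eq =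
  trans (sym (opposite-involutive i)) (trans (cong opposite eq) (opposite-involutive i′))
reflectIf-injective false eq = eq

-- The three vertex sums are distinct

uSum vSum : ℕ → ℕ → ℕ
uSum k n = suc n + (6 * n * n + 8 * n + 3) * (2 * k + 1)
vSum k n = suc n + 2 * (suc n * suc n) * (2 * k + 1)

xSum : ℕ → ℕ → ℕ → ℕ
xSum k n s = (2 * s + 1) * ((8 * k + 5) + 2 * n * (4 * k + 2))

xSum-digits : ∀ k n s → xSum k n s ≡ suc (2 * s) + 4 * suc (2 * s) * suc n * (2 * k + 1)
xSum-digits k n s = identity k n s
  where
  identity : ∀ k n s → (2 * s + 1) * ((8 * k + 5) + 2 * n * (4 * k + 2))
                     ≡ suc (2 * s) + 4 * suc (2 * s) * suc n * (2 * k + 1)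
  identity = solve-∀

6n²+8n+3-odd : ∀ n → 6 * n * n + 8 * n + 3 ≡ suc (2 * (3 * n * n + 4 * n + 1))
6n²+8n+3-odd = solve-∀

digits-unique : ∀ K {c₁ c₂ q₁ q₂} → c₁ < K → c₂ < K →
  c₁ + q₁ * K ≡ c₂ + q₂ * K → c₁ ≡ c₂ × q₁ ≡ q₂
digits-unique (suc K) {c₁} {c₂} {q₁} {q₂} c₁<K c₂<K eq = c₁≡c₂ ,
  *-cancelʳ-≡ q₁ q₂ (suc K) (+-cancelˡ-≡ c₁ _ _ (trans eq (cong (_+ q₂ * suc K) (sym c₁≡c₂))))
  where
  open ≡-Reasoning
  c₁≡c₂ : c₁ ≡ c₂
  c₁≡c₂ = begin
    c₁                        ≡⟨ m<n⇒m%n≡m c₁<K ⟨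
    c₁ % suc K                ≡⟨ [m+kn]%n≡m%n c₁ q₁ (suc K) ⟨
    (c₁ + q₁ * suc K) % suc K ≡⟨ cong (_% suc K) eq ⟩
    (c₂ + q₂ * suc K) % suc K ≡⟨ [m+kn]%n≡m%n c₂ q₂ (suc K) ⟩
    c₂ % suc K                ≡⟨ m<n⇒m%n≡m c₂<K ⟩
    c₂                        ∎

n<3*n : ∀ {n} → 0 < n → n < 3 * n
n<3*n {n} 0<n = m<m+n n (<-≤-trans 0<n (m≤m+n n (n + 0)))

-- If m < K, the base-K digits force m = S and A = 4Sm;
-- otherwise m ≥ K ≥ 3S makes the left side larger.
m+A*K≢S+4Sm*K : ∀ {K S m A} → 0 < S → 3 * S ≤ K → 2 * (m * m) ≤ A →
  (m ≡ S → A ≢ 4 * S * m) → m + A * K ≢ S + 4 * S * m * K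
m+A*K≢S+4Sm*K {K} {S} {m} {A} 0<S 3S≤K 2m²≤A A≢4Sm eq with m <? K
... | yes m<K =
  uncurry A≢4Sm (digits-unique K {q₁ = A} {q₂ = 4 * S * m} m<K (<-≤-trans (n<3*n 0<S) 3S≤K) eq)
... | no m≮K = <⇒≢ (+-mono-<-≤ (<-≤-trans (n<3*n 0<S) 3S≤m) (*-monoˡ-≤ K 4Sm≤A)) (sym eq)
  where
  open ≤-Reasoning
  3S≤m : 3 * S ≤ m
  3S≤m = ≤-trans 3S≤K (≮⇒≥ m≮K)
  4Sm≤A : 4 * S * m ≤ A
  4Sm≤A = *-cancelˡ-≤ 3 (begin
    3 * (4 * S * m)          ≡⟨ solve (S ∷ m ∷ []) ⟩
    4 * (3 * S) * m          ≤⟨ *-monoˡ-≤ m (*-monoʳ-≤ 4 3S≤m) ⟩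
    4 * m * m                ≤⟨ m≤m+n (4 * m * m) (2 * (m * m)) ⟩
    4 * m * m + 2 * (m * m)  ≡⟨ solve (m ∷ []) ⟩
    3 * (2 * (m * m))        ≤⟨ *-monoʳ-≤ 3 2m²≤A ⟩
    3 * A                    ∎)

uSum≢vSum : ∀ k n → uSum k n ≢ vSum k n
uSum≢vSum k n eq =
  even≢odd (suc n * suc n) (3 * n * n + 4 * n + 1) (sym (trans (sym (6n²+8n+3-odd n)) A≡A′))
  where
  A≡A′ : 6 * n * n + 8 * n + 3 ≡ 2 * (suc n * suc n)
  A≡A′ = *-cancelʳ-≡ _ _ (2 * k + 1) {{≢-nonZero (m+1+n≢0 (2 * k))}} (+-cancelˡ-≡ (suc n) _ _ eq)

uSum≢xSum : ∀ k n s → 3 * suc (2 * s) ≤ 2 * k + 1 → uSum k n ≢ xSum k n s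
uSum≢xSum k n s 3S≤K eq = m+A*K≢S+4Sm*K z<s 3S≤K 2m²≤A A≢4Sm (trans eq (xSum-digits k n s))
  where
  identity₁ : ∀ n → 2 * (suc n * suc n) + (4 * n * n + 4 * n + 1) ≡ 6 * n * n + 8 * n + 3
  identity₁ = solve-∀
  identity₂ : ∀ s n → 2 * (2 * suc (2 * s) * suc n) ≡ 4 * suc (2 * s) * suc n
  identity₂ = solve-∀
  2m²≤A : 2 * (suc n * suc n) ≤ 6 * n * n + 8 * n + 3
  2m²≤A = subst (2 * (suc n * suc n) ≤_) (identity₁ n) (m≤m+n _ (4 * n * n + 4 * n + 1))
  A≢4Sm : suc n ≡ suc (2 * s) → 6 * n * n + 8 * n + 3 ≢ 4 * suc (2 * s) * suc n
  A≢4Sm _ A≡4Sm = even≢odd (2 * suc (2 * s) * suc n) (3 * n * n + 4 * n + 1)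
    (trans (identity₂ s n) (trans (sym A≡4Sm) (6n²+8n+3-odd n)))

vSum≢xSum : ∀ k n s → 3 * suc (2 * s) ≤ 2 * k + 1 → vSum k n ≢ xSum k n s
vSum≢xSum k n s 3S≤K eq = m+A*K≢S+4Sm*K z<s 3S≤K ≤-refl A≢4Sm (trans eq (xSum-digits k n s))
  where
  identity : ∀ n → 4 * suc n * suc n ≡ 2 * (suc n * suc n) + 2 * (suc n * suc n)
  identity = solve-∀
  A≢4Sm : suc n ≡ suc (2 * s) → 2 * (suc n * suc n) ≢ 4 * suc (2 * s) * suc n
  A≢4Sm m≡S A≡4Sm = 0≢1+n (+-cancelˡ-≡ (2 * (suc n * suc n)) 0 (2 * (suc n * suc n))
    (trans (+-identityʳ _) (trans A≡4Sm 4Sm≡2A)))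
    where
    4Sm≡2A : 4 * suc (2 * s) * suc n ≡ 2 * (suc n * suc n) + 2 * (suc n * suc n)
    4Sm≡2A = trans (cong (λ S → 4 * S * suc n) (sym m≡S)) (identity n)

3[2s+1]≤2k+1 : ∀ r s → r ≥ 1 → 3 * suc (2 * s) ≤ 2 * (2 * r * s + r + s) + 1
3[2s+1]≤2k+1 (suc r) s _ = subst (3 * suc (2 * s) ≤_) (identity r s) (m≤m+n _ (2 * r * suc (2 * s)))
  where
  identity : ∀ r s → 3 * suc (2 * s) + 2 * r * suc (2 * s) ≡ 2 * (2 * suc r * s + suc r + s) + 1
  identity = solve-∀

-- Closed forms of the labeling f

2k+1≤ak+b : ∀ k a b → 2 ≤ a → 1 ≤ b → 2 * k + 1 ≤ a * k + b
2k+1≤ak+b k a b 2≤a 1≤b = +-mono-≤ (*-monoˡ-≤ k 2≤a) 1≤b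

data ParityView : ℕ → Set where
  even : ∀ t → ParityView (2 * t)
  odd  : ∀ t → ParityView (suc (2 * t))

parityView : ∀ m → ParityView m
parityView zero = even 0
parityView (suc m) with parityView m
... | even t = odd t
... | odd  t = subst ParityView (*-suc 2 t) (even (suc t))

isOdd-2* : ∀ t → isOdd (2 * t) ≡ false
isOdd-2+2* : ∀ t → isOdd (suc (suc (2 * t))) ≡ false

isOdd-2* zero    = refl
isOdd-2* (suc t) = subst (λ m → isOdd m ≡ false) (sym (*-suc 2 t)) (isOdd-2+2* t)

isOdd-2+2* t rewrite isOdd-2* t = refl

isOdd-1+2* : ∀ t → isOdd (suc (2 * t)) ≡ true
isOdd-1+2* t rewrite isOdd-2* t = refl

⌊2*/2⌋ : ∀ t → ⌊ 2 * t /2⌋ ≡ t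
⌊2*/2⌋ zero    = refl
⌊2*/2⌋ (suc t) = subst (λ m → ⌊ m /2⌋ ≡ suc t) (sym (*-suc 2 t)) (cong suc (⌊2*/2⌋ t))

⌊1+2*/2⌋ : ∀ t → ⌊ suc (2 * t) /2⌋ ≡ t
⌊1+2*/2⌋ zero    = refl
⌊1+2*/2⌋ (suc t) = subst (λ m → ⌊ suc m /2⌋ ≡ suc t) (sym (*-suc 2 t)) (cong suc (⌊1+2*/2⌋ t))

fU-last : ∀ k n i → fU k n i (2 * n) ≡ (2 * k + 2 ∸ i) + (n + 1) * (4 * k + 2)
fU-last k n i = if-yes (2 * n ≟ℕ 2 * n) refl

fU-even : ∀ k t d i →
  fU k (t + suc d) i (2 * t) ≡ (6 * k + 4 ∸ i) + (t + suc d + suc d) * (4 * k + 2)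
fU-even k t d i
  rewrite ⌊⌋-no (2 * t ≟ℕ 2 * (t + suc d)) (m+1+n≢m t ∘ sym ∘ *-cancelˡ-≡ t (t + suc d) 2)
        | isOdd-2* t | ⌊2*/2⌋ t | m+n∸m≡n t (suc d) = refl

fU-odd : ∀ k t d i →
  fU k (t + suc d) i (suc (2 * t)) ≡ (2 * k + 1 + i) + (t + suc d + suc d) * (4 * k + 2)
fU-odd k t d i
  rewrite ⌊⌋-no (suc (2 * t) ≟ℕ 2 * (t + suc d)) (even≢odd (t + suc d) t ∘ sym)
        | isOdd-1+2* t | ⌊1+2*/2⌋ t | m+n∸m≡n t (suc d) = refl

fV-odd : ∀ k n i t → fV k n i (suc (2 * t)) ≡ (2 * k + 2 ∸ i) + suc t * (4 * k + 2)
fV-odd k n i t rewrite isOdd-1+2* t | ⌊2*/2⌋ t = refl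

fV-even : ∀ k n i t → fV k n i (suc (suc (2 * t))) ≡ (2 * k + 1 + i) + suc t * (4 * k + 2)
fV-even k n i t rewrite isOdd-2* t | ⌊2*/2⌋ t = refl

∸-pair : ∀ {c i} → i ≤ c → ∀ b Q → ((c ∸ i) + Q) + ((b + i) + Q) ≡ c + b + 2 * Q
∸-pair {c} {i} i≤c b Q = trans (regroup (c ∸ i) i b Q) (cong (λ a → a + b + 2 * Q) (m∸n+n≡m i≤c))
  where
  regroup : ∀ a i b Q → (a + Q) + ((b + i) + Q) ≡ (a + i) + b + 2 * Q
  regroup = solve-∀

fU-pair : ∀ k t d i → i ≤ 6 * k + 4 →
  fU k (t + suc d) i (2 * t) + fU k (t + suc d) i (suc (2 * t))
    ≡ (6 * k + 4) + (2 * k + 1) + 2 * ((t + suc d + suc d) * (4 * k + 2))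
fU-pair k t d i i≤ = trans (cong₂ _+_ (fU-even k t d i) (fU-odd k t d i)) (∸-pair i≤ (2 * k + 1) _)

fV-pair : ∀ k n i t → i ≤ 2 * k + 2 →
  fV k n i (suc (2 * t)) + fV k n i (suc (suc (2 * t)))
    ≡ (2 * k + 2) + (2 * k + 1) + 2 * (suc t * (4 * k + 2))
fV-pair k n i t i≤ = trans (cong₂ _+_ (fV-odd k n i t) (fV-even k n i t)) (∸-pair i≤ (2 * k + 1) _)

-- n is split as m + d so that the induction on the number m of pairs keeps n fixed.
∑fU-pairs : ∀ k i → i ≤ 6 * k + 4 → ∀ m d →
  ∑[ j < 2 * m ] fU k (m + d) i (toℕ j) ≡ m * (8 * k + 5) + (3 * m * m + m + 4 * m * d) * (4 * k + 2)
∑fU-pairs k i i≤ zero    d = refl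
∑fU-pairs k i i≤ (suc m) d = begin
  ∑[ j < 2 * suc m ] fU k (suc m + d) i (toℕ j)
    ≡⟨ cong₂ (λ M n → ∑[ j < M ] fU k n i (toℕ j)) (*-suc 2 m) (sym (+-suc m d)) ⟩
  ∑[ j < suc (suc (2 * m)) ] F (toℕ j)
    ≡⟨ ∑-suc-suc (2 * m) F ⟩
  ∑[ j < 2 * m ] F (toℕ j) + (F (2 * m) + F (suc (2 * m)))
    ≡⟨ cong₂ _+_ (∑fU-pairs k i i≤ m (suc d)) (fU-pair k m d i i≤) ⟩
  m * (8 * k + 5) + (3 * m * m + m + 4 * m * suc d) * (4 * k + 2)
    + ((6 * k + 4) + (2 * k + 1) + 2 * ((m + suc d + suc d) * (4 * k + 2)))
    ≡⟨ collect k m d ⟩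
  suc m * (8 * k + 5) + (3 * suc m * suc m + suc m + 4 * suc m * d) * (4 * k + 2) ∎
  where
  open ≡-Reasoning
  F : ℕ → ℕ
  F = fU k (m + suc d) i
  collect : ∀ k m d → m * (8 * k + 5) + (3 * m * m + m + 4 * m * suc d) * (4 * k + 2)
                        + ((6 * k + 4) + (2 * k + 1) + 2 * ((m + suc d + suc d) * (4 * k + 2)))
                    ≡ suc m * (8 * k + 5) + (3 * suc m * suc m + suc m + 4 * suc m * d) * (4 * k + 2)
  collect = solve-∀

∑fV-pairs : ∀ k n i → i ≤ 2 * k + 2 → ∀ m →
  ∑[ j < suc (2 * m) ] fV k n i (toℕ j) ≡ (4 * k + 3 ∸ i) + (m * (4 * k + 3) + m * suc m * (4 * k + 2))
∑fV-pairs k n i i≤ zero    = refl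
∑fV-pairs k n i i≤ (suc m) = begin
  ∑[ j < suc (2 * suc m) ] F (toℕ j)
    ≡⟨ cong (λ M → ∑[ j < suc M ] F (toℕ j)) (*-suc 2 m) ⟩
  ∑[ j < suc (suc (suc (2 * m))) ] F (toℕ j)
    ≡⟨ ∑-suc-suc (suc (2 * m)) F ⟩
  ∑[ j < suc (2 * m) ] F (toℕ j) + (F (suc (2 * m)) + F (suc (suc (2 * m))))
    ≡⟨ cong₂ _+_ (∑fV-pairs k n i i≤ m) (fV-pair k n i m i≤) ⟩
  (4 * k + 3 ∸ i) + (m * (4 * k + 3) + m * suc m * (4 * k + 2))
    + ((2 * k + 2) + (2 * k + 1) + 2 * (suc m * (4 * k + 2)))
    ≡⟨ collect (4 * k + 3 ∸ i) k m ⟩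
  (4 * k + 3 ∸ i) + (suc m * (4 * k + 3) + suc m * suc (suc m) * (4 * k + 2)) ∎
  where
  open ≡-Reasoning
  F : ℕ → ℕ
  F = fV k n i
  collect : ∀ a k m → a + (m * (4 * k + 3) + m * suc m * (4 * k + 2))
                        + ((2 * k + 2) + (2 * k + 1) + 2 * (suc m * (4 * k + 2)))
                    ≡ a + (suc m * (4 * k + 3) + suc m * suc (suc m) * (4 * k + 2))
  collect = solve-∀

i+∑fU≡uSum : ∀ k n i → i ≤ 2 * k + 1 → i + ∑[ j < 2 * n + 1 ] fU k n i (toℕ j) ≡ uSum k n
i+∑fU≡uSum k n i i≤ = begin
  i + ∑[ j < 2 * n + 1 ] F (toℕ j)
    ≡⟨ cong (λ M → i + ∑[ j < M ] F (toℕ j)) (+-comm (2 * n) 1) ⟩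
  i + ∑[ j < suc (2 * n) ] F (toℕ j)
    ≡⟨ cong (i +_) (∑-suc (2 * n) F) ⟩
  i + (∑[ j < 2 * n ] F (toℕ j) + F (2 * n))
    ≡⟨ cong₂ (λ a b → i + (a + b)) pairs (fU-last k n i) ⟩
  i + (pairSum + ((2 * k + 2 ∸ i) + (n + 1) * (4 * k + 2)))
    ≡⟨ regroup i pairSum (2 * k + 2 ∸ i) ((n + 1) * (4 * k + 2)) ⟩
  pairSum + (i + (2 * k + 2 ∸ i)) + (n + 1) * (4 * k + 2)
    ≡⟨ cong (λ a → pairSum + a + (n + 1) * (4 * k + 2)) (m+[n∸m]≡n i≤2k+2) ⟩
  pairSum + (2 * k + 2) + (n + 1) * (4 * k + 2)
    ≡⟨ collect k n ⟩
  uSum k n ∎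
  where
  open ≡-Reasoning
  F : ℕ → ℕ
  F = fU k n i
  pairSum : ℕ
  pairSum = n * (8 * k + 5) + (3 * n * n + n + 4 * n * 0) * (4 * k + 2)
  i≤2k+2 : i ≤ 2 * k + 2
  i≤2k+2 = ≤-trans i≤ (2k+1≤ak+b k 2 2 (s≤s (s≤s z≤n)) (s≤s z≤n))
  i≤6k+4 : i ≤ 6 * k + 4
  i≤6k+4 = ≤-trans i≤ (2k+1≤ak+b k 6 4 (s≤s (s≤s z≤n)) (s≤s z≤n))
  pairs : ∑[ j < 2 * n ] F (toℕ j) ≡ pairSum
  pairs = trans (cong (λ n′ → ∑[ j < 2 * n ] fU k n′ i (toℕ j)) (sym (+-identityʳ n)))
                (∑fU-pairs k i i≤6k+4 n 0)
  regroup : ∀ a b c d → a + (b + (c + d)) ≡ b + (a + c) + d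
  regroup = solve-∀
  collect : ∀ k n → n * (8 * k + 5) + (3 * n * n + n + 4 * n * 0) * (4 * k + 2)
                      + (2 * k + 2) + (n + 1) * (4 * k + 2)
                  ≡ suc n + (6 * n * n + 8 * n + 3) * (2 * k + 1)
  collect = solve-∀

i+∑fV≡vSum : ∀ k n i → i ≤ 2 * k + 1 → i + ∑[ j < 2 * n + 1 ] fV k n i (toℕ j) ≡ vSum k n
i+∑fV≡vSum k n i i≤ = begin
  i + ∑[ j < 2 * n + 1 ] F (toℕ j)
    ≡⟨ cong (λ M → i + ∑[ j < M ] F (toℕ j)) (+-comm (2 * n) 1) ⟩
  i + ∑[ j < suc (2 * n) ] F (toℕ j)
    ≡⟨ cong (i +_) (∑fV-pairs k n i i≤2k+2 n) ⟩
  i + ((4 * k + 3 ∸ i) + rest)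
    ≡⟨ sym (+-assoc i _ rest) ⟩
  (i + (4 * k + 3 ∸ i)) + rest
    ≡⟨ cong (_+ rest) (m+[n∸m]≡n i≤4k+3) ⟩
  (4 * k + 3) + rest
    ≡⟨ collect k n ⟩
  vSum k n ∎
  where
  open ≡-Reasoning
  F : ℕ → ℕ
  F = fV k n i
  rest : ℕ
  rest = n * (4 * k + 3) + n * suc n * (4 * k + 2)
  i≤2k+2 : i ≤ 2 * k + 2
  i≤2k+2 = ≤-trans i≤ (2k+1≤ak+b k 2 2 (s≤s (s≤s z≤n)) (s≤s z≤n))
  i≤4k+3 : i ≤ 4 * k + 3
  i≤4k+3 = ≤-trans i≤ (2k+1≤ak+b k 4 3 (s≤s (s≤s z≤n)) (s≤s z≤n))
  collect : ∀ k n → (4 * k + 3) + (n * (4 * k + 3) + n * suc n * (4 * k + 2))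
                  ≡ suc n + 2 * (suc n * suc n) * (2 * k + 1)
  collect = solve-∀

m≡n+o⇒m∸n≡o : ∀ {m} n {o} → m ≡ n + o → m ∸ n ≡ o
m≡n+o⇒m∸n≡o n {o} refl = m+n∸m≡n n o

∸-suc-toℕ≡opposite : ∀ a {b m} (i : Fin m) →
  b ≡ a + m → b ∸ suc (toℕ i) ≡ a + toℕ (opposite i)
∸-suc-toℕ≡opposite a i refl =
  trans (+-∸-assoc a (toℕ<n i)) (cong (a +_) (sym (opposite-prop i)))

-- The three cases in the definition of fU, with n = t + 1 + d to avoid truncated subtraction.
data Slot : ℕ → ℕ → Set where
  last : ∀ n → Slot n (2 * n)
  even : ∀ t d → Slot (t + suc d) (2 * t)
  odd  : ∀ t d → Slot (t + suc d) (suc (2 * t))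

slot : ∀ n j₀ → j₀ ≤ 2 * n → Slot n j₀
slot n j₀ j₀≤2n with parityView j₀
... | even t with m≤n⇒∃[o]m+o≡n (*-cancelˡ-≤ 2 j₀≤2n)
...   | zero  , t+0≡n = subst (λ n → Slot n (2 * t)) (trans (sym (+-identityʳ t)) t+0≡n) (last t)
...   | suc d , t+d≡n = subst (λ n → Slot n (2 * t)) t+d≡n (even t d)
slot n j₀ j₀≤2n | odd t with m≤n⇒∃[o]m+o≡n (*-cancelˡ-< 2 t n j₀≤2n)
...   | d , 1+t+d≡n = subst (λ n → Slot n (suc (2 * t))) (trans (+-suc t d) 1+t+d≡n) (odd t d)

2k+2≡1+[2k+1] : ∀ k → 2 * k + 2 ≡ 1 + (2 * k + 1)
2k+2≡1+[2k+1] = solve-∀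

uxLabel : ∀ k n → Fin (2 * k + 1) → ℕ → Bool → ℕ
uxLabel k n i ĵ b = suc ((2 * k + 1) * suc (2 * n + 1 + ĵ) + toℕ (reflectIf (not b) i))

vxLabel : ∀ k → Fin (2 * k + 1) → ℕ → Bool → ℕ
vxLabel k i j₀ b = suc ((2 * k + 1) * suc j₀ + toℕ (reflectIf b i))

fU-code : ∀ k n (i : Fin (2 * k + 1)) {j₀} → Slot n j₀ →
  fU k n (suc (toℕ i)) j₀ ≡ uxLabel k n i (2 * n + 1 ∸ suc j₀) (isOdd j₀)
fU-code k n i (last n) = begin
  fU k n (suc (toℕ i)) (2 * n)
    ≡⟨ fU-last k n (suc (toℕ i)) ⟩
  (2 * k + 2 ∸ suc (toℕ i)) + (n + 1) * (4 * k + 2)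
    ≡⟨ cong (_+ (n + 1) * (4 * k + 2)) (∸-suc-toℕ≡opposite 1 i (2k+2≡1+[2k+1] k)) ⟩
  (1 + toℕ (opposite i)) + (n + 1) * (4 * k + 2)
    ≡⟨ collect k n (toℕ (opposite i)) ⟩
  uxLabel k n i 0 false
    ≡⟨ cong₂ (uxLabel k n i) (sym (m≡n+o⇒m∸n≡o (suc (2 * n)) (2n+1≡1+2n+0 n))) (sym (isOdd-2* n)) ⟩
  uxLabel k n i (2 * n + 1 ∸ suc (2 * n)) (isOdd (2 * n)) ∎
  where
  open ≡-Reasoning
  2n+1≡1+2n+0 : ∀ n → 2 * n + 1 ≡ suc (2 * n) + 0
  2n+1≡1+2n+0 = solve-∀
  collect : ∀ k n ī → (1 + ī) + (n + 1) * (4 * k + 2) ≡ suc ((2 * k + 1) * suc (2 * n + 1 + 0) + ī)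
  collect = solve-∀
fU-code k n i (even t d) = begin
  fU k m (suc (toℕ i)) (2 * t)
    ≡⟨ fU-even k t d (suc (toℕ i)) ⟩
  (6 * k + 4 ∸ suc (toℕ i)) + (m + suc d) * (4 * k + 2)
    ≡⟨ cong (_+ (m + suc d) * (4 * k + 2)) (∸-suc-toℕ≡opposite (4 * k + 3) i (6k+4≡4k+3+K k)) ⟩
  (4 * k + 3 + toℕ (opposite i)) + (m + suc d) * (4 * k + 2)
    ≡⟨ collect k t d (toℕ (opposite i)) ⟩
  uxLabel k m i (2 * suc d) false
    ≡⟨ cong₂ (uxLabel k m i) (sym (m≡n+o⇒m∸n≡o (suc (2 * t)) (2m+1≡1+2t+2+2d t d))) (sym (isOdd-2* t)) ⟩
  uxLabel k m i (2 * m + 1 ∸ suc (2 * t)) (isOdd (2 * t)) ∎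
  where
  open ≡-Reasoning
  m : ℕ
  m = t + suc d
  6k+4≡4k+3+K : ∀ k → 6 * k + 4 ≡ (4 * k + 3) + (2 * k + 1)
  6k+4≡4k+3+K = solve-∀
  2m+1≡1+2t+2+2d : ∀ t d → 2 * (t + suc d) + 1 ≡ suc (2 * t) + 2 * suc d
  2m+1≡1+2t+2+2d = solve-∀
  collect : ∀ k t d ī → (4 * k + 3 + ī) + (t + suc d + suc d) * (4 * k + 2)
                      ≡ suc ((2 * k + 1) * suc (2 * (t + suc d) + 1 + 2 * suc d) + ī)
  collect = solve-∀
fU-code k n i (odd t d) = begin
  fU k m (suc (toℕ i)) (suc (2 * t))
    ≡⟨ fU-odd k t d (suc (toℕ i)) ⟩
  (2 * k + 1 + suc (toℕ i)) + (m + suc d) * (4 * k + 2)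
    ≡⟨ collect k t d (toℕ i) ⟩
  uxLabel k m i (suc (2 * d)) true
    ≡⟨ cong₂ (uxLabel k m i) (sym (m≡n+o⇒m∸n≡o (suc (suc (2 * t))) (2m+1≡2+2t+1+2d t d)))
                             (sym (isOdd-1+2* t)) ⟩
  uxLabel k m i (2 * m + 1 ∸ suc (suc (2 * t))) (isOdd (suc (2 * t))) ∎
  where
  open ≡-Reasoning
  m : ℕ
  m = t + suc d
  2m+1≡2+2t+1+2d : ∀ t d → 2 * (t + suc d) + 1 ≡ suc (suc (2 * t)) + suc (2 * d)
  2m+1≡2+2t+1+2d = solve-∀
  collect : ∀ k t d i → (2 * k + 1 + suc i) + (t + suc d + suc d) * (4 * k + 2)
                      ≡ suc ((2 * k + 1) * suc (2 * (t + suc d) + 1 + suc (2 * d)) + i)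
  collect = solve-∀

vReflected : ℕ → Bool
vReflected zero      = true
vReflected (suc j₀) = isOdd (suc j₀)

fV-code : ∀ k n (i : Fin (2 * k + 1)) j₀ → fV k n (suc (toℕ i)) j₀ ≡ vxLabel k i j₀ (vReflected j₀)
fV-code k n i zero =
  trans (∸-suc-toℕ≡opposite (2 * k + 2) i (4k+3≡2k+2+K k)) (collect k (toℕ (opposite i)))
  where
  4k+3≡2k+2+K : ∀ k → 4 * k + 3 ≡ (2 * k + 2) + (2 * k + 1)
  4k+3≡2k+2+K = solve-∀
  collect : ∀ k ī → 2 * k + 2 + ī ≡ suc ((2 * k + 1) * 1 + ī)
  collect = solve-∀
fV-code k n i (suc j₀) with parityView j₀
... | even t = begin
  fV k n (suc (toℕ i)) (suc (2 * t))
    ≡⟨ fV-odd k n (suc (toℕ i)) t ⟩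
  (2 * k + 2 ∸ suc (toℕ i)) + suc t * (4 * k + 2)
    ≡⟨ cong (_+ suc t * (4 * k + 2)) (∸-suc-toℕ≡opposite 1 i (2k+2≡1+[2k+1] k)) ⟩
  (1 + toℕ (opposite i)) + suc t * (4 * k + 2)
    ≡⟨ collect k t (toℕ (opposite i)) ⟩
  vxLabel k i (suc (2 * t)) true
    ≡⟨ cong (vxLabel k i (suc (2 * t))) (sym (isOdd-1+2* t)) ⟩
  vxLabel k i (suc (2 * t)) (isOdd (suc (2 * t))) ∎
  where
  open ≡-Reasoning
  collect : ∀ k t ī → (1 + ī) + suc t * (4 * k + 2) ≡ suc ((2 * k + 1) * suc (suc (2 * t)) + ī)
  collect = solve-∀
... | odd t = begin
  fV k n (suc (toℕ i)) (suc (suc (2 * t)))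
    ≡⟨ fV-even k n (suc (toℕ i)) t ⟩
  (2 * k + 1 + suc (toℕ i)) + suc t * (4 * k + 2)
    ≡⟨ collect k t (toℕ i) ⟩
  vxLabel k i (suc (suc (2 * t))) false
    ≡⟨ cong (vxLabel k i (suc (suc (2 * t)))) (sym (isOdd-2+2* t)) ⟩
  vxLabel k i (suc (suc (2 * t))) (isOdd (suc (suc (2 * t)))) ∎
  where
  open ≡-Reasoning
  collect : ∀ k t i → (2 * k + 1 + suc i) + suc t * (4 * k + 2)
                    ≡ suc ((2 * k + 1) * suc (suc (suc (2 * t))) + i)
  collect = solve-∀

-- The graphs of the class

module Construction (k n r : ℕ) (P : Partitions k n r) where

  K N R : ℕ
  K = 2 * k + 1
  N = 2 * n + 1
  R = 2 * r + 1

  G : Graph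
  G = GraphOf k n r P

  data Vertex : Set where
    u v : Fin K → Vertex
    x   : Fin N → Fin R → Vertex

  data Edge : Set where
    uv     : Fin K → Edge
    ux vx  : Fin K → Fin N → Edge

  endpoints : Edge → Vertex × Vertex
  endpoints (uv i)   = u i , v i
  endpoints (ux i j) = u i , x j (P j i)
  endpoints (vx i j) = v i , x j (P j i)

  vertex : Vertex → Fin (nV G)
  vertex (u i)   = uV k n r i
  vertex (v i)   = vV k n r i
  vertex (x j b) = xV k n r j b

  toVertex : Fin (nV G) → Vertex
  toVertex w = [ [ u , v ]′ ∘ splitAt K , uncurry x ∘ remQuot R ]′ (splitAt (K + K) w)

  vertex-toVertex : ∀ w → vertex (toVertex w) ≡ w
  vertex-toVertex w = trans (vertex-split (splitAt (K + K) w)) (join-splitAt (K + K) (N * R) w)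
    where
    vertex-uv : ∀ s → vertex ([ u , v ]′ s) ≡ join K K s ↑ˡ (N * R)
    vertex-uv (inj₁ i) = refl
    vertex-uv (inj₂ i) = refl
    vertex-split : ∀ s → vertex ([ [ u , v ]′ ∘ splitAt K , uncurry x ∘ remQuot R ]′ s)
                         ≡ join (K + K) (N * R) s
    vertex-split (inj₁ w′) = trans (vertex-uv (splitAt K w′)) (cong (_↑ˡ (N * R)) (join-splitAt K K w′))
    vertex-split (inj₂ c)  = cong ((K + K) ↑ʳ_) (combine-remQuot {N} R c)

  toVertex-vertex : ∀ a → toVertex (vertex a) ≡ a
  toVertex-vertex (u i)   rewrite splitAt-↑ˡ (K + K) (i ↑ˡ K) (N * R) | splitAt-↑ˡ K i K = refl
  toVertex-vertex (v i)   rewrite splitAt-↑ˡ (K + K) (K ↑ʳ i) (N * R) | splitAt-↑ʳ K K i = refl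
  toVertex-vertex (x j b) rewrite splitAt-↑ʳ (K + K) (N * R) (combine j b) =
    cong (uncurry x) (remQuot-combine j b)

  vertex-injective : Injective _≡_ _≡_ vertex
  vertex-injective {a} {b} eq = trans (sym (toVertex-vertex a)) (trans (cong toVertex eq) (toVertex-vertex b))

  edge : Edge → Fin (nE G)
  edge (uv i)   = i ↑ˡ (K * N + K * N)
  edge (ux i j) = K ↑ʳ (combine i j ↑ˡ (K * N))
  edge (vx i j) = K ↑ʳ ((K * N) ↑ʳ combine i j)

  uxOrVx : Fin (K * N) ⊎ Fin (K * N) → Edge
  uxOrVx = [ uncurry ux ∘ remQuot N , uncurry vx ∘ remQuot N ]′

  toEdge : Fin (nE G) → Edge
  toEdge e = [ uv , uxOrVx ∘ splitAt (K * N) ]′ (splitAt K e)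

  edge-toEdge : ∀ e → edge (toEdge e) ≡ e
  edge-toEdge e = trans (edge-split (splitAt K e)) (join-splitAt K (K * N + K * N) e)
    where
    edge-uxOrVx : ∀ s → edge (uxOrVx s) ≡ K ↑ʳ join (K * N) (K * N) s
    edge-uxOrVx (inj₁ c) = cong (λ c → K ↑ʳ (c ↑ˡ (K * N))) (combine-remQuot {K} N c)
    edge-uxOrVx (inj₂ c) = cong (λ c → K ↑ʳ ((K * N) ↑ʳ c)) (combine-remQuot {K} N c)
    edge-split : ∀ s → edge ([ uv , uxOrVx ∘ splitAt (K * N) ]′ s) ≡ join K (K * N + K * N) s
    edge-split (inj₁ i) = refl
    edge-split (inj₂ c) =
      trans (edge-uxOrVx (splitAt (K * N) c)) (cong (K ↑ʳ_) (join-splitAt (K * N) (K * N) c))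

  toEdge-edge : ∀ e → toEdge (edge e) ≡ e
  toEdge-edge (uv i) rewrite splitAt-↑ˡ K i (K * N + K * N) = refl
  toEdge-edge (ux i j) rewrite splitAt-↑ʳ K (K * N + K * N) (combine i j ↑ˡ (K * N))
                             | splitAt-↑ˡ (K * N) (combine i j) (K * N) =
    cong (uncurry ux) (remQuot-combine i j)
  toEdge-edge (vx i j) rewrite splitAt-↑ʳ K (K * N + K * N) ((K * N) ↑ʳ combine i j)
                             | splitAt-↑ʳ (K * N) (K * N) (combine i j) =
    cong (uncurry vx) (remQuot-combine i j)

  ends-edge : ∀ e → ends G (edge e) ≡ (vertex (proj₁ (endpoints e)) , vertex (proj₂ (endpoints e)))
  ends-edge (uv i) rewrite splitAt-↑ˡ K i (K * N + K * N) = refl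
  ends-edge (ux i j) rewrite splitAt-↑ʳ K (K * N + K * N) (combine i j ↑ˡ (K * N))
                           | splitAt-↑ˡ (K * N) (combine i j) (K * N) =
    cong (λ (i , j) → vertex (u i) , vertex (x j (P j i))) (remQuot-combine i j)
  ends-edge (vx i j) rewrite splitAt-↑ʳ K (K * N + K * N) ((K * N) ↑ʳ combine i j)
                           | splitAt-↑ʳ (K * N) (K * N) (combine i j) =
    cong (λ (i , j) → vertex (v i) , vertex (x j (P j i))) (remQuot-combine i j)

  apart : ∀ a b → a ≢ b → ⌊ vertex a ≟ vertex b ⌋ ≡ false
  apart a b a≢b = ⌊⌋-no (vertex a ≟ vertex b) (a≢b ∘ vertex-injective)

  -- Unlike ⌊ vertex a ≟ vertex b ⌋, this test computes on constructors, so `incidence` below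
  -- reduces to 0 on most vertex–edge pairs.
  _≡ᵇ_ : Vertex → Vertex → Bool
  u i   ≡ᵇ u i′    = ⌊ i ≟ i′ ⌋
  v i   ≡ᵇ v i′    = ⌊ i ≟ i′ ⌋
  x j b ≡ᵇ x j′ b′ = ⌊ j ≟ j′ ⌋ ∧ ⌊ b ≟ b′ ⌋
  _     ≡ᵇ _       = false

  vertex-≟ : ∀ a b → ⌊ vertex a ≟ vertex b ⌋ ≡ a ≡ᵇ b
  vertex-≟ (u i) (u i′) with i ≟ i′
  ... | yes refl = ⌊⌋-yes (vertex (u i) ≟ vertex (u i)) refl
  ... | no i≢i′  = apart (u i) (u i′) λ { refl → i≢i′ refl }
  vertex-≟ (v i) (v i′) with i ≟ i′
  ... | yes refl = ⌊⌋-yes (vertex (v i) ≟ vertex (v i)) refl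
  ... | no i≢i′  = apart (v i) (v i′) λ { refl → i≢i′ refl }
  vertex-≟ (x j b) (x j′ b′) with j ≟ j′ | b ≟ b′
  ... | yes refl | yes refl = ⌊⌋-yes (vertex (x j b) ≟ vertex (x j b)) refl
  ... | yes refl | no b≢b′  = apart (x j b) (x j b′) λ { refl → b≢b′ refl }
  ... | no j≢j′  | _        = apart (x j b) (x j′ b′) λ { refl → j≢j′ refl }
  vertex-≟ a@(u _)   b@(v _)   = apart a b λ ()
  vertex-≟ a@(u _)   b@(x _ _) = apart a b λ ()
  vertex-≟ a@(v _)   b@(u _)   = apart a b λ ()
  vertex-≟ a@(v _)   b@(x _ _) = apart a b λ ()
  vertex-≟ a@(x _ _) b@(u _)   = apart a b λ ()
  vertex-≟ a@(x _ _) b@(v _)   = apart a b λ ()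

  incidence : Labeling G → Vertex → Edge → ℕ
  incidence f a e = (if a ≡ᵇ proj₁ (endpoints e) then label G f (edge e) else 0)
                  + (if a ≡ᵇ proj₂ (endpoints e) then label G f (edge e) else 0)

  contrib-edge : ∀ f a e → contrib G f (vertex a) (edge e) ≡ incidence f a e
  contrib-edge f a e
    rewrite ends-edge e | vertex-≟ a (proj₁ (endpoints e)) | vertex-≟ a (proj₂ (endpoints e)) = refl

  f⁺-vertex : ∀ f a → f⁺ G f (vertex a) ≡ ∑[ i < K ] incidence f a (uv i)
    + (∑[ i < K ] ∑[ j < N ] incidence f a (ux i j) + ∑[ i < K ] ∑[ j < N ] incidence f a (vx i j))
  f⁺-vertex f a =
    trans (sum-map-allFin (nE G) c)
    (trans (∑-↑ K (K * N + K * N) c)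
    (cong₂ _+_ (sum-cong-≗ {K} λ i → contrib-edge f a (uv i))
      (trans (∑-↑ (K * N) (K * N) (λ e → c (K ↑ʳ e)))
        (cong₂ _+_ (trans (∑-combine K N _) (∑∑-cong λ i j → contrib-edge f a (ux i j)))
                   (trans (∑-combine K N _) (∑∑-cong λ i j → contrib-edge f a (vx i j)))))))
    where
    c : Fin (nE G) → ℕ
    c = contrib G f (vertex a)
    ∑∑-cong : ∀ {g h : Fin K → Fin N → ℕ} → (∀ i j → g i j ≡ h i j) →
      ∑[ i < K ] ∑[ j < N ] g i j ≡ ∑[ i < K ] ∑[ j < N ] h i j
    ∑∑-cong g≡h = sum-cong-≗ {K} λ i → sum-cong-≗ {N} (g≡h i)

  -- f(e) − 1 = K · place e + digit e: the edges u_i v_i fill layer 0, v_i x_{i,j} layer j and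
  -- u_i x_{i,j} layer 4n + 3 − j; inside a layer the digit is i − 1 or its reflection K − i.
  place : Edge → Fin (suc (N + N))
  place (uv _)   = fzero
  place (vx _ j) = fsuc (j ↑ˡ N)
  place (ux _ j) = fsuc (N ↑ʳ opposite j)

  digit : Edge → Fin K
  digit (uv i)   = i
  digit (ux i j) = reflectIf (not (isOdd (toℕ j))) i
  digit (vx i j) = reflectIf (vReflected (toℕ j)) i

  code : Edge → Fin (suc (N + N) * K)
  code e = combine (place e) (digit e)

  code-injective : Injective _≡_ _≡_ code
  code-injective {e} {e′} eq = uncurry (place-digit-injective e e′) (combine-injective _ _ _ _ eq)
    where
    place-digit-injective : ∀ e e′ → place e ≡ place e′ → digit e ≡ digit e′ → e ≡ e′
    place-digit-injective (uv i)   (uv i′)    _ i≡i′ = cong uv i≡i′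
    place-digit-injective (vx i j) (vx i′ j′) p d with ↑ˡ-injective N j j′ (Fin.suc-injective p)
    ... | refl = cong (λ i → vx i j) (reflectIf-injective (vReflected (toℕ j)) d)
    place-digit-injective (ux i j) (ux i′ j′) p d
      with reflectIf-injective true (↑ʳ-injective N _ _ (Fin.suc-injective p))
    ... | refl = cong (λ i → ux i j) (reflectIf-injective (not (isOdd (toℕ j))) d)
    place-digit-injective (vx _ j) (ux _ j′) p _ =
      contradiction (Fin.suc-injective p) (↑ˡ≢↑ʳ j (opposite j′))
    place-digit-injective (ux _ j) (vx _ j′) p _ =
      contradiction (sym (Fin.suc-injective p)) (↑ˡ≢↑ʳ j′ (opposite j))
    place-digit-injective (uv _)   (ux _ _)  () _
    place-digit-injective (uv _)   (vx _ _)  () _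
    place-digit-injective (ux _ _) (uv _)    () _
    place-digit-injective (vx _ _) (uv _)    () _

  weight : Edge → ℕ
  weight (uv i)   = suc (toℕ i)
  weight (ux i j) = fU k n (suc (toℕ i)) (toℕ j)
  weight (vx i j) = fV k n (suc (toℕ i)) (toℕ j)

  weight≡1+code : ∀ e → weight e ≡ suc (toℕ (code e))
  weight≡1+code (uv i) = cong suc (sym (toℕ-↑ˡ i ((N + N) * K)))
  weight≡1+code (ux i j) = trans (fU-code k n i (slot n (toℕ j) j≤2n)) (cong suc (sym (begin
    toℕ (code (ux i j))                          ≡⟨ toℕ-combine (place (ux i j)) d ⟩
    K * suc (toℕ (N ↑ʳ opposite j)) + toℕ d      ≡⟨ cong (λ p → K * suc p + toℕ d) (toℕ-↑ʳ N (opposite j)) ⟩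
    K * suc (N + toℕ (opposite j)) + toℕ d       ≡⟨ cong (λ p → K * suc (N + p) + toℕ d) (opposite-prop j) ⟩
    K * suc (N + (N ∸ suc (toℕ j))) + toℕ d      ∎)))
    where
    open ≡-Reasoning
    d : Fin K
    d = digit (ux i j)
    j≤2n : toℕ j ≤ 2 * n
    j≤2n = m<1+n⇒m≤n (subst (toℕ j <_) (+-comm (2 * n) 1) (toℕ<n j))
  weight≡1+code (vx i j) = trans (fV-code k n i (toℕ j)) (cong suc (sym
    (trans (toℕ-combine (place (vx i j)) d) (cong (λ p → K * suc p + toℕ d) (toℕ-↑ˡ j N)))))
    where
    d : Fin K
    d = digit (vx i j)

  private
    size : suc (N + N) * K ≡ nE G
    size = identity K N
      where
      identity : ∀ K N → suc (N + N) * K ≡ K + (K * N + K * N)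
      identity = solve-∀

  assign : Fin (nE G) → Fin (nE G)
  assign e = cast size (code (toEdge e))

  assign-injective : Injective _≡_ _≡_ assign
  assign-injective {e} {e′} eq = trans (sym (edge-toEdge e)) (trans (cong edge toEdge≡) (edge-toEdge e′))
    where
    toEdge≡ : toEdge e ≡ toEdge e′
    toEdge≡ = code-injective (toℕ-injective
      (trans (sym (toℕ-cast size _)) (trans (cong toℕ eq) (toℕ-cast size _))))

  labeling : Labeling G
  labeling = mk⤖ (assign-injective , injective⇒surjective assign-injective)

  ℓ : Edge → ℕ
  ℓ e = label G labeling (edge e)

  ℓ≡weight : ∀ e → ℓ e ≡ weight e
  ℓ≡weight e = trans (cong suc (trans (toℕ-cast size _) (cong (toℕ ∘ code) (toEdge-edge e))))
                     (sym (weight≡1+code e))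

  f⁺-u : ∀ i₀ → f⁺ G labeling (vertex (u i₀)) ≡ uSum k n
  f⁺-u i₀ = begin
    f⁺ G labeling (vertex (u i₀))
      ≡⟨ f⁺-vertex labeling (u i₀) ⟩
    ∑[ i < K ] inc (uv i) + (∑[ i < K ] ∑[ j < N ] inc (ux i j) + ∑[ i < K ] ∑[ j < N ] inc (vx i j))
      ≡⟨ cong₂ _+_ (∑-δ+0 K i₀ (ℓ ∘ uv)) (cong₂ _+_ (∑∑-δ+0 K N i₀ λ i j → ℓ (ux i j)) (∑∑-zero K N)) ⟩
    ℓ (uv i₀) + (∑[ j < N ] ℓ (ux i₀ j) + 0)
      ≡⟨ cong₂ _+_ (ℓ≡weight (uv i₀)) (trans (+-identityʳ _) (sum-cong-≗ {N} λ j → ℓ≡weight (ux i₀ j))) ⟩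
    suc (toℕ i₀) + ∑[ j < N ] fU k n (suc (toℕ i₀)) (toℕ j)
      ≡⟨ i+∑fU≡uSum k n (suc (toℕ i₀)) (toℕ<n i₀) ⟩
    uSum k n ∎
    where
    open ≡-Reasoning
    inc : Edge → ℕ
    inc = incidence labeling (u i₀)

  f⁺-v : ∀ i₀ → f⁺ G labeling (vertex (v i₀)) ≡ vSum k n
  f⁺-v i₀ = begin
    f⁺ G labeling (vertex (v i₀))
      ≡⟨ f⁺-vertex labeling (v i₀) ⟩
    ∑[ i < K ] inc (uv i) + (∑[ i < K ] ∑[ j < N ] inc (ux i j) + ∑[ i < K ] ∑[ j < N ] inc (vx i j))
      ≡⟨ cong₂ _+_ (∑-δ K i₀ (ℓ ∘ uv)) (cong₂ _+_ (∑∑-zero K N) (∑∑-δ+0 K N i₀ λ i j → ℓ (vx i j))) ⟩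
    ℓ (uv i₀) + ∑[ j < N ] ℓ (vx i₀ j)
      ≡⟨ cong₂ _+_ (ℓ≡weight (uv i₀)) (sum-cong-≗ {N} λ j → ℓ≡weight (vx i₀ j)) ⟩
    suc (toℕ i₀) + ∑[ j < N ] fV k n (suc (toℕ i₀)) (toℕ j)
      ≡⟨ i+∑fV≡vSum k n (suc (toℕ i₀)) (toℕ<n i₀) ⟩
    vSum k n ∎
    where
    open ≡-Reasoning
    inc : Edge → ℕ
    inc = incidence labeling (v i₀)

  3≤numValues : ∀ f → IsLocalAntimagic G f → 3 ≤ numValues G f
  3≤numValues f antimagic =
    triangle⇒3≤numValues G f antimagic (edge (uv i₀)) (edge (ux i₀ j₀)) (edge (vx i₀ j₀))
      (ends-edge (uv i₀)) (ends-edge (ux i₀ j₀)) (ends-edge (vx i₀ j₀))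
    where
    i₀ : Fin K
    i₀ = 2 * k ↑ʳ fzero
    j₀ : Fin N
    j₀ = 2 * n ↑ʳ fzero

  module Admissible (s : ℕ) (valid : ValidPartitions k n r s P) where

    f⁺-x : ∀ j₀ b₀ → f⁺ G labeling (vertex (x j₀ b₀)) ≡ xSum k n s
    f⁺-x j₀ b₀ = begin
      f⁺ G labeling (vertex (x j₀ b₀))
        ≡⟨ f⁺-vertex labeling (x j₀ b₀) ⟩
      ∑[ i < K ] inc (uv i) + (∑[ i < K ] ∑[ j < N ] inc (ux i j) + ∑[ i < K ] ∑[ j < N ] inc (vx i j))
        ≡⟨ cong₂ _+_ (∑-zero K) (cong₂ _+_ (sum-cong-≗ {K} λ i → ∑-δ-∧ N j₀ (inBlock i) λ j → ℓ (ux i j))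
                                            (sum-cong-≗ {K} λ i → ∑-δ-∧ N j₀ (inBlock i) λ j → ℓ (vx i j))) ⟩
      ∑[ i < K ] (if inBlock i j₀ then ℓ (ux i j₀) else 0) + ∑[ i < K ] (if inBlock i j₀ then ℓ (vx i j₀) else 0)
        ≡⟨ sym (∑-distrib-+ {K} _ _) ⟩
      ∑[ i < K ] ((if inBlock i j₀ then ℓ (ux i j₀) else 0) + (if inBlock i j₀ then ℓ (vx i j₀) else 0))
        ≡⟨ sum-cong-≗ {K} (λ i → trans (if-+ (inBlock i j₀) _ _)
             (cong₂ (λ b L → if b then L else 0) (≟-sym b₀ (P j₀ i))
                    (cong₂ _+_ (ℓ≡weight (ux i j₀)) (ℓ≡weight (vx i j₀))))) ⟩
      ∑[ i < K ] (if ⌊ P j₀ i ≟ b₀ ⌋ then σ k n i j₀ else 0)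
        ≡⟨ sym (sum-map-allFin K _) ⟩
      sum (map (λ i → if ⌊ P j₀ i ≟ b₀ ⌋ then σ k n i j₀ else 0) (allFin K))
        ≡⟨ sym (sum-map-filter (λ i → P j₀ i ≟ b₀) (λ i → σ k n i j₀) (allFin K)) ⟩
      sum (map (λ i → σ k n i j₀) (block {k} {n} {r} P j₀ b₀))
        ≡⟨ proj₂ (valid j₀ b₀) ⟩
      xSum k n s ∎
      where
      open ≡-Reasoning
      inc : Edge → ℕ
      inc = incidence labeling (x j₀ b₀)
      inBlock : Fin K → Fin N → Bool
      inBlock i j = ⌊ b₀ ≟ P j i ⌋
      if-+ : ∀ b (L M : ℕ) → (if b then L else 0) + (if b then M else 0) ≡ (if b then L + M else 0)
      if-+ true  L M = refl
      if-+ false L M = refl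

    numValues-labeling≤3 : numValues G labeling ≤ 3
    numValues-labeling≤3 = numValues≤length G labeling (uSum k n ∷ vSum k n ∷ xSum k n s ∷ [])
      λ w → subst (λ w → f⁺ G labeling w ∈ _) (vertex-toVertex w) (sum∈ (toVertex w))
      where
      sum∈ : ∀ a → f⁺ G labeling (vertex a) ∈ (uSum k n ∷ vSum k n ∷ xSum k n s ∷ [])
      sum∈ (u i)   = here (f⁺-u i)
      sum∈ (v i)   = there (here (f⁺-v i))
      sum∈ (x j b) = there (there (here (f⁺-x j b)))

    labeling-antimagic : 3 * suc (2 * s) ≤ K → IsLocalAntimagic G labeling
    labeling-antimagic 3[2s+1]≤K e =
      subst (Apart ∘ ends G) (edge-toEdge e) (subst Apart (sym (ends-edge (toEdge e))) (endpoints-apart (toEdge e)))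
      where
      Apart : Fin (nV G) × Fin (nV G) → Set
      Apart (w , w′) = f⁺ G labeling w ≢ f⁺ G labeling w′
      endpoints-apart : ∀ e → Apart (vertex (proj₁ (endpoints e)) , vertex (proj₂ (endpoints e)))
      endpoints-apart (uv i)   eq = uSum≢vSum k n (trans (sym (f⁺-u i)) (trans eq (f⁺-v i)))
      endpoints-apart (ux i j) eq = uSum≢xSum k n s 3[2s+1]≤K (trans (sym (f⁺-u i)) (trans eq (f⁺-x j (P j i))))
      endpoints-apart (vx i j) eq = vSum≢xSum k n s 3[2s+1]≤K (trans (sym (f⁺-v i)) (trans eq (f⁺-x j (P j i))))

theorem3p2 : (n r s : ℕ) → n ≥ 1 → r ≥ 1 → s ≥ 1 →
    (k : ℕ) → k ≡ 2 * r * s + r + s →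
    (G : Graph) → InClass k n r s G → χla≡ G 3
theorem3p2 n r s _ r≥1 _ k refl G (P , valid , refl) =
  (labeling , antimagic , ≤-antisym numValues-labeling≤3 (3≤numValues labeling antimagic)) , 3≤numValues
  where
  open Construction k n r P
  open Admissible s valid
  antimagic : IsLocalAntimagic (GraphOf k n r P) labeling
  antimagic = labeling-antimagic (3[2s+1]≤2k+1 r s r≥1)
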